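{- Let $G$ be an abelian group and $\mathcal A=(A_1,\dots,A_q)$ a tuple of subsets of $G$ such that for each $i$, $A_i$ is a union of $k_i$ unbounded linear sets ($k_i\in\mathbb N$). Then for every $r\in\mathbb N$, $\mathcal A$ is a chromatic asymptotic $(r,\ell)$-approximate group with \[ \ell=\prod_{i=1}^q\binom{(r+1)(k_i-1)}{k_i-1}. \]
   Context: $\mathbb N=\{1,2,\dots\}$, $\mathbb N_0=\{0,1,2,\dots\}$. An unbounded linear set in $G$ is a set of the form $P(a;b_1,\dots,b_d)=\{a+n_1b_1+\cdots+n_db_d:n_1,\dots,n_d\in\mathbb N_0\}$ with $a,b_1,\dots,b_d\in G$. For subsets $X,Y$, $X+Y=\{x+y:x\in X,y\in Y\}$; for $h\in\mathbb N$, $hA$ is the $h$-fold sumset $A+\cdots+A$ and $0A=\{0\}$. For $\mathbf h=(h_1,\dots,h_q)\in\mathbb N_0^q$, $\mathbf h\cdot\mathcal A=h_1A_1+\cdots+h_qA_q$, $r\mathbf h=(rh_1,\dots,rh_q)$, and $\mathbf h\preceq\mathbf h'$ means $h_i\le h_i'$ for all $i$. $\mathcal A$ is a chromatic asymptotic $(r,\ell)$-approximate group if there is $\mathbf h_0\in\mathbb N_0^q$ such that for every $\mathbf h\succeq\mathbf h_0$ there is $X_{\mathbf h}\subseteq G$ with $|X_{\mathbf h}|\le\ell$ and $(r\mathbf h)\cdot\mathcal A\subseteq X_{\mathbf h}+\mathbf h\cdot\mathcal A$. -}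

module Defs where

open import Level using (Level; _⊔_; Lift)
open import Algebra.Bundles using (AbelianGroup)
open import Data.Nat using (ℕ; zero; suc; _*_; _∸_; _≤_)
open import Data.Nat.Combinatorics using (_C_)
open import Data.Fin using (Fin; zero; suc)
open import Data.Product using (Σ; ∃; _×_; _,_)
open import Data.List using (List; length)
open import Data.List.Relation.Unary.Any using (Any)
import Algebra.Definitions.RawMonoid as RM

prodFin : ∀ {q} → (Fin q → ℕ) → ℕ
prodFin {zero}  f = 1
prodFin {suc q} f = f zero * prodFin (λ i → f (suc i))

module _ {c ℓ : Level} (G : AbelianGroup c ℓ) where
  open AbelianGroup G
  open RM rawMonoid using (sum) renaming (_×_ to _·_)

  Subset : (a : Level) → Set (c Level.⊔ Level.suc a)
  Subset a = Carrier → Set a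

  -- Data for an unbounded linear set P(a; b_1,…,b_d) (d ∈ ℕ₀).
  record LinData : Set c where
    field
      dim  : ℕ
      base : Carrier
      gens : Fin dim → Carrier

  LinSet : LinData → Subset ℓ
  LinSet L z = Σ (Fin dim → ℕ) λ n → z ≈ base ∙ sum (λ j → n j · gens j)
    where open LinData L

  _⊕_ : ∀ {a b} → Subset a → Subset b → Subset (c ⊔ ℓ ⊔ a ⊔ b)
  (X ⊕ Y) z = Σ Carrier λ x → Σ Carrier λ y → X x × Y y × z ≈ x ∙ y

  _⊗_ : ∀ {a : Level} → ℕ → Subset a → Subset (c ⊔ ℓ ⊔ a)
  (_⊗_ {a} zero A) z = Lift (c ⊔ a) (z ≈ ε)
  (suc h ⊗ A) z = (A ⊕ (h ⊗ A)) z

  dotSum : ∀ {a q} → (Fin q → ℕ) → (Fin q → Subset a) → Subset (c ⊔ ℓ ⊔ a)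
  dotSum {a} {q = zero}  h A z = Lift (c ⊔ a) (z ≈ ε)
  dotSum {q = suc q} h A z =
    ((h zero ⊗ A zero) ⊕ dotSum (λ i → h (suc i)) (λ i → A (suc i))) z

  _⊕L_ : ∀ {b} → List Carrier → Subset b → Subset (c ⊔ ℓ ⊔ b)
  (X ⊕L Y) z = Any (λ x → Σ Carrier λ y → Y y × z ≈ x ∙ y) X

  ChromaticAsymptoticApproxGroup :
    ∀ {a q} → (Fin q → Subset a) → (r l : ℕ) → Set (c ⊔ ℓ ⊔ a)
  ChromaticAsymptoticApproxGroup {q = q} A r l =
    Σ (Fin q → ℕ) λ h₀ → (h : Fin q → ℕ) → (∀ i → h₀ i ≤ h i) →
      Σ (List Carrier) λ X → length X ≤ l ×
        (∀ z → dotSum (λ i → r * h i) A z → (X ⊕L dotSum h A) z)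

  UnionOfLinSets : ∀ {a} → Subset a → ℕ → Set (c ⊔ ℓ ⊔ a)
  UnionOfLinSets A k = Σ (Fin k → LinData) λ L →
    ∀ z → (A z → ∃ λ j → LinSet (L j) z) × ((∃ λ j → LinSet (L j) z) → A z)

module Submission where

-- Write A = ⋃_{j<k} P(a_j; B_j). Every z ∈ hA is a sum ∑_j z_j with z_j ∈ m_j P(a_j; B_j) and
-- ∑ m = h, and (d + m′)P(a; B) ⊆ d a + m′P(a; B) when m′ ≥ 1. Hence z ∈ (rh)A lies in
-- ∑_j d_j a_j + hA as soon as ∑ d = (r - 1)h and d_j < m_j wherever m_j > 0 (d_j = 0 otherwise).
-- Such a d can be drawn from a set of C(n + k - 1, k - 1) vectors depending only on h, one for each
-- weak composition g of n := r(k - 1) into k parts: writing (r - 1)h = s n + e with e < n, take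
-- d = s g + e′ where e′ ≤ g is a greedy share of e. For h ≥ r(n + k) the caps
-- q_j = ⌊(m_j - 1)/(s + 1)⌋ satisfy ∑ q ≥ n, so some composition g ≤ q exists, and then
-- d ≤ (s + 1) g ≤ m - 1. For a tuple 𝒜 the lists of translates of the coordinates are added,
-- which multiplies their lengths.

open import Level using (Level; _⊔_; lift)
open import Function using (_∘_)
open import Algebra.Bundles using (AbelianGroup; CommutativeMonoid)
open import Data.Nat using (ℕ; zero; suc; pred; _+_; _*_; _∸_; _⊓_; _≤_; _<_; z≤n; s≤s⁻¹; NonZero)
open import Data.Nat.Properties
open import Data.Nat.DivMod using (_/_; _%_; m≡m%n+[m/n]*n; m%n<n; m/n*n≤m)
open import Data.Nat.Combinatorics using (_C_; nCn≡1; nCk+nC[k+1]≡[n+1]C[k+1])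
open import Data.Nat.Tactic.RingSolver using (solve-∀)
open import Data.Fin using (Fin; zero; suc)
open import Data.Vec.Functional using (Vector; []; _∷_; head; tail; updateAt)
open import Data.Vec.Functional.Properties using (∷-cong)
open import Data.List as List using (List; [_]; map; _++_; length; cartesianProductWith)
open import Data.List.Properties using (length-map; length-++)
open import Data.List.Relation.Unary.Any as Any using (Any; here)
open import Data.List.Relation.Unary.Any.Properties using (map⁺; ++⁺ˡ; ++⁺ʳ; cartesianProductWith⁺)
open import Data.Product using (Σ; _×_; _,_; proj₁; proj₂)
open import Data.Sum using (inj₁; inj₂)
open import Relation.Unary using (_⊆_; ⋃)
open import Relation.Binary.PropositionalEquality as ≡
  using (_≡_; refl; cong; cong₂; subst; _≗_; module ≡-Reasoning)
open import Algebra.Properties.Semiring.Sum +-*-semiring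
  using (sum; sum-replicate-zero; sum-cong-≗; ∑-distrib-+; *-distribˡ-sum; *-distribʳ-sum)
open import Algebra.Properties.CommutativeSemigroup +-commutativeSemigroup
  using () renaming (x∙yz≈y∙xz to x+yz≡y+xz)
open import Defs
  using (prodFin; Subset; LinData; LinSet; dotSum; ChromaticAsymptoticApproxGroup; UnionOfLinSets)

module _ {c ℓ} (M : CommutativeMonoid c ℓ) where
  open CommutativeMonoid M
  open import Algebra.Definitions.RawMonoid rawMonoid using () renaming (sum to ∑)
  open import Algebra.Properties.CommutativeSemigroup commutativeSemigroup using (x∙yz≈y∙xz)

  ∑-updateAt : ∀ {n} (v : Vector Carrier n) (j : Fin n) (x : Carrier) →
               ∑ (updateAt v j (x ∙_)) ≈ x ∙ ∑ v
  ∑-updateAt v zero    x = assoc x (head v) (∑ (tail v))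
  ∑-updateAt v (suc j) x =
    trans (∙-congˡ (∑-updateAt (tail v) j x)) (x∙yz≈y∙xz (head v) x (∑ (tail v)))

sum-mono-≤ : ∀ {k} {f g : Vector ℕ k} → (∀ j → f j ≤ g j) → sum f ≤ sum g
sum-mono-≤ {zero}  _   = z≤n
sum-mono-≤ {suc k} f≤g = +-mono-≤ (f≤g zero) (sum-mono-≤ (f≤g ∘ suc))

sum-suc : ∀ {k} (f : Vector ℕ k) → sum (λ j → suc (f j)) ≡ k + sum f
sum-suc {zero}  f = refl
sum-suc {suc k} f =
  cong suc (≡.trans (cong (head f +_) (sum-suc (tail f))) (x+yz≡y+xz (head f) k (sum (tail f))))

sum-∸ : ∀ {k} {d m : Vector ℕ k} → (∀ j → d j ≤ m j) → sum (λ j → m j ∸ d j) ≡ sum m ∸ sum d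
sum-∸ {d = d} {m} d≤m = ≡.trans (≡.sym (m+n∸m≡n (sum d) _)) (cong (_∸ sum d) Σd+Σ[m∸d]≡Σm)
  where
    Σd+Σ[m∸d]≡Σm : sum d + sum (λ j → m j ∸ d j) ≡ sum m
    Σd+Σ[m∸d]≡Σm = ≡.trans (≡.sym (∑-distrib-+ d (λ j → m j ∸ d j)))
                           (sum-cong-≗ (λ j → m+[n∸m]≡n (d≤m j)))

m≤[1+pred[m]/n]*n : ∀ m n .{{_ : NonZero n}} → m ≤ suc (pred m / n) * n
m≤[1+pred[m]/n]*n zero    n = z≤n
m≤[1+pred[m]/n]*n (suc m) n = begin
  suc m                    ≡⟨ cong suc (m≡m%n+[m/n]*n m n) ⟩
  suc (m % n + m / n * n)  ≤⟨ +-monoˡ-≤ (m / n * n) (m%n<n m n) ⟩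
  n + m / n * n            ∎
  where open ≤-Reasoning

compositions : (k n : ℕ) → List (Vector ℕ k)
compositions zero    zero    = [ [] ]
compositions zero    (suc n) = List.[]
compositions (suc k) zero    = map (0 ∷_) (compositions k zero)
compositions (suc k) (suc n) =
  map (λ g → suc (head g) ∷ tail g) (compositions (suc k) n) ++ map (0 ∷_) (compositions k (suc n))

length-compositions-zero : ∀ k → length (compositions k 0) ≡ 1
length-compositions-zero zero    = refl
length-compositions-zero (suc k) =
  ≡.trans (length-map (0 ∷_) (compositions k 0)) (length-compositions-zero k)

length-compositions : ∀ k n → length (compositions (suc k) n) ≡ (n + k) C k
length-compositions k zero = ≡.trans (length-compositions-zero (suc k)) (≡.sym (nCn≡1 k))
length-compositions zero (suc n) = begin
  length (map _ (compositions 1 n) ++ List.[])  ≡⟨ length-++ (map _ (compositions 1 n)) ⟩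
  length (map _ (compositions 1 n)) + 0         ≡⟨ +-identityʳ _ ⟩
  length (map _ (compositions 1 n))             ≡⟨ length-map _ (compositions 1 n) ⟩
  length (compositions 1 n)                     ≡⟨ length-compositions zero n ⟩
  1                                             ∎
  where open ≡-Reasoning
length-compositions (suc k) (suc n) = begin
  length (map _ (compositions (2 + k) n) ++ map (0 ∷_) (compositions (suc k) (suc n)))
    ≡⟨ length-++ (map _ (compositions (2 + k) n)) ⟩
  length (map _ (compositions (2 + k) n)) + length (map (0 ∷_) (compositions (suc k) (suc n)))
    ≡⟨ cong₂ _+_ (length-map _ (compositions (2 + k) n))
                 (length-map (0 ∷_) (compositions (suc k) (suc n))) ⟩
  length (compositions (2 + k) n) + length (compositions (suc k) (suc n))
    ≡⟨ cong₂ _+_ (length-compositions (suc k) n) (length-compositions k (suc n)) ⟩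
  (n + suc k) C suc k + (suc n + k) C k
    ≡⟨ cong (λ x → (n + suc k) C suc k + x C k) (≡.sym (+-suc n k)) ⟩
  (n + suc k) C suc k + (n + suc k) C k
    ≡⟨ +-comm ((n + suc k) C suc k) _ ⟩
  (n + suc k) C k + (n + suc k) C suc k
    ≡⟨ nCk+nC[k+1]≡[n+1]C[k+1] (n + suc k) k ⟩
  suc (n + suc k) C suc k
    ∎
  where open ≡-Reasoning

mutual
  compositions-complete : ∀ k n (g : Vector ℕ k) → sum g ≡ n → Any (_≗ g) (compositions k n)
  compositions-complete zero    zero    g _     = here (λ ())
  compositions-complete zero    (suc n) g ()
  compositions-complete (suc k) n       g Σg≡n =
    Any.map (λ v≗ → ∷-cong (v≗ zero) (v≗ ∘ suc))
            (∷-compositions-complete k n (head g) (tail g) Σg≡n)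

  ∷-compositions-complete : ∀ k n x (v : Vector ℕ k) → x + sum v ≡ n →
                            Any (_≗ (x ∷ v)) (compositions (suc k) n)
  ∷-compositions-complete k zero    zero    v Σv≡0 =
    map⁺ (Any.map (∷-cong refl) (compositions-complete k 0 v Σv≡0))
  ∷-compositions-complete k (suc n) zero    v Σv≡n =
    ++⁺ʳ _ (map⁺ (Any.map (∷-cong refl) (compositions-complete k (suc n) v Σv≡n)))
  ∷-compositions-complete k (suc n) (suc x) v x+Σv≡n =
    ++⁺ˡ (map⁺ (Any.map (λ u≗ → ∷-cong (cong suc (u≗ zero)) (u≗ ∘ suc))
                        (∷-compositions-complete k n x v (suc-injective x+Σv≡n))))

fill : ∀ {k} → ℕ → Vector ℕ k → Vector ℕ k
fill {zero}  e c = []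
fill {suc k} e c = (head c ⊓ e) ∷ fill (e ∸ head c) (tail c)

fill-≤ : ∀ {k} e (c : Vector ℕ k) j → fill e c j ≤ c j
fill-≤ e c zero    = m⊓n≤m (head c) e
fill-≤ e c (suc j) = fill-≤ (e ∸ head c) (tail c) j

fill-cong : ∀ {k} e {c c′ : Vector ℕ k} → c ≗ c′ → fill e c ≗ fill e c′
fill-cong e c≗c′ zero = cong₂ _⊓_ (c≗c′ zero) refl
fill-cong e {c} {c′} c≗c′ (suc j) rewrite c≗c′ zero = fill-cong (e ∸ head c′) (c≗c′ ∘ suc) j

sum-fill : ∀ {k} e (c : Vector ℕ k) → e ≤ sum c → sum (fill e c) ≡ e
sum-fill {zero}  e c e≤0 = ≡.sym (n≤0⇒n≡0 e≤0)
sum-fill {suc k} e c e≤Σc with ≤-total (head c) e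
... | inj₁ c₀≤e = begin
  head c ⊓ e + sum (fill (e ∸ head c) (tail c))
    ≡⟨ cong₂ _+_ (m≤n⇒m⊓n≡m c₀≤e) (sum-fill (e ∸ head c) (tail c) e∸c₀≤Σc′) ⟩
  head c + (e ∸ head c)
    ≡⟨ m+[n∸m]≡n c₀≤e ⟩
  e ∎
  where
    open ≡-Reasoning
    e∸c₀≤Σc′ : e ∸ head c ≤ sum (tail c)
    e∸c₀≤Σc′ = ≤-trans (∸-monoˡ-≤ (head c) e≤Σc) (≤-reflexive (m+n∸m≡n (head c) _))
... | inj₂ e≤c₀ = begin
  head c ⊓ e + sum (fill (e ∸ head c) (tail c))
    ≡⟨ cong₂ _+_ (m≥n⇒m⊓n≡n e≤c₀) (cong (λ e′ → sum (fill e′ (tail c))) (m≤n⇒m∸n≡0 e≤c₀)) ⟩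
  e + sum (fill 0 (tail c))
    ≡⟨ cong (e +_) (sum-fill 0 (tail c) z≤n) ⟩
  e + 0
    ≡⟨ +-identityʳ e ⟩
  e ∎
  where open ≡-Reasoning

spread : ∀ {k} (n R : ℕ) .{{_ : NonZero n}} → Vector ℕ k → Vector ℕ k
spread n R g j = R / n * g j + fill (R % n) g j

spread-cong : ∀ {k} n R .{{_ : NonZero n}} {g g′ : Vector ℕ k} →
              g ≗ g′ → spread n R g ≗ spread n R g′
spread-cong n R g≗g′ j = cong₂ _+_ (cong (R / n *_) (g≗g′ j)) (fill-cong (R % n) g≗g′ j)

spread-≤ : ∀ {k} n R .{{_ : NonZero n}} (g : Vector ℕ k) j → spread n R g j ≤ suc (R / n) * g j
spread-≤ n R g j = ≤-trans (+-monoʳ-≤ (R / n * g j) (fill-≤ (R % n) g j))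
                           (≤-reflexive (+-comm (R / n * g j) (g j)))

sum-spread : ∀ {k} n R .{{_ : NonZero n}} (g : Vector ℕ k) → sum g ≡ n → sum (spread n R g) ≡ R
sum-spread n R g Σg≡n = begin
  sum (spread n R g)                              ≡⟨ ∑-distrib-+ (λ j → R / n * g j) (fill (R % n) g) ⟩
  sum (λ j → R / n * g j) + sum (fill (R % n) g)  ≡⟨ cong₂ _+_ (≡.sym (*-distribˡ-sum (R / n) g))
                                                               (sum-fill (R % n) g R%n≤Σg) ⟩
  R / n * sum g + R % n                           ≡⟨ cong (λ x → R / n * x + R % n) Σg≡n ⟩
  R / n * n + R % n                               ≡⟨ +-comm (R / n * n) (R % n) ⟩
  R % n + R / n * n                               ≡⟨ ≡.sym (m≡m%n+[m/n]*n R n) ⟩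
  R                                               ∎
  where
    open ≡-Reasoning
    R%n≤Σg : R % n ≤ sum g
    R%n≤Σg = ≤-trans (<⇒≤ (m%n<n R n)) (≤-reflexive (≡.sym Σg≡n))

spread-≤-pred : ∀ {k} n R .{{_ : NonZero n}} (m : Vector ℕ (suc k)) →
                (n + k) * suc (R / n) < sum m →
                Any (λ g → sum (spread n R g) ≡ R × (∀ j → spread n R g j ≤ pred (m j)))
                    (compositions (suc k) n)
spread-≤-pred {k} n R m bound = Any.map below (compositions-complete (suc k) n g Σg≡n)
  where
    t : ℕ
    t = suc (R / n)
    q : Vector ℕ (suc k)
    q j = pred (m j) / t
    g : Vector ℕ (suc k)
    g = fill n q

    Σm≤[k+Σq]*t : sum m ≤ (suc k + sum q) * t
    Σm≤[k+Σq]*t = begin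
      sum m                      ≤⟨ sum-mono-≤ (λ j → m≤[1+pred[m]/n]*n (m j) t) ⟩
      sum (λ j → suc (q j) * t)  ≡⟨ ≡.sym (*-distribʳ-sum t (λ j → suc (q j))) ⟩
      sum (λ j → suc (q j)) * t  ≡⟨ cong (_* t) (sum-suc q) ⟩
      (suc k + sum q) * t        ∎
      where open ≤-Reasoning

    n≤Σq : n ≤ sum q
    n≤Σq = +-cancelˡ-≤ k n (sum q) (≤-trans (≤-reflexive (+-comm k n))
             (s≤s⁻¹ (*-cancelʳ-< t (n + k) (suc k + sum q) (<-≤-trans bound Σm≤[k+Σq]*t))))

    Σg≡n : sum g ≡ n
    Σg≡n = sum-fill n q n≤Σq

    below : ∀ {v} → v ≗ g → sum (spread n R v) ≡ R × (∀ j → spread n R v j ≤ pred (m j))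
    below {v} v≗g = sum-spread n R v (≡.trans (sum-cong-≗ v≗g) Σg≡n) , λ j → begin
      spread n R v j  ≡⟨ spread-cong n R v≗g j ⟩
      spread n R g j  ≤⟨ spread-≤ n R g j ⟩
      t * g j         ≤⟨ *-monoʳ-≤ t (fill-≤ n q j) ⟩
      t * q j         ≡⟨ *-comm t (q j) ⟩
      q j * t         ≤⟨ m/n*n≤m (pred (m j)) t ⟩
      pred (m j)      ∎
      where open ≤-Reasoning

spread-threshold : ∀ r k n h .{{_ : NonZero n}} → suc r * k ≤ n → suc r * (n + suc k) ≤ h →
                   (n + k) * suc (r * h / n) < suc r * h
spread-threshold r k n h rk≤n h₀≤h = begin-strict
  (n + k) * suc s          ≡⟨ expand n k s ⟩
  (n + k + s * k) + s * n  <⟨ +-mono-<-≤ small (m/n*n≤m (r * h) n) ⟩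
  h + r * h                ∎
  where
    open ≤-Reasoning
    s : ℕ
    s = r * h / n
    expand : ∀ n k s → (n + k) * suc s ≡ (n + k + s * k) + s * n
    expand = solve-∀
    expand′ : ∀ r n k s → suc r * suc (n + k + s * k) ≡ suc r * (n + suc k) + s * (suc r * k)
    expand′ = solve-∀
    small : n + k + s * k < h
    small = *-cancelˡ-≤ (suc r) (begin
      suc r * suc (n + k + s * k)            ≡⟨ expand′ r n k s ⟩
      suc r * (n + suc k) + s * (suc r * k)  ≤⟨ +-mono-≤ h₀≤h (*-monoʳ-≤ s rk≤n) ⟩
      h + s * n                              ≤⟨ +-monoʳ-≤ h (m/n*n≤m (r * h) n) ⟩
      h + r * h                              ∎)

length-cartesianProductWith : ∀ {a b c} {A : Set a} {B : Set b} {C : Set c} (f : A → B → C) xs ys →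
                              length (cartesianProductWith f xs ys) ≡ length xs * length ys
length-cartesianProductWith f List.[]       ys = refl
length-cartesianProductWith f (x List.∷ xs) ys =
  ≡.trans (length-++ (map (f x) ys))
          (cong₂ _+_ (length-map (f x) ys) (length-cartesianProductWith f xs ys))

prodFin-mono-≤ : ∀ {q} {f g : Fin q → ℕ} → (∀ i → f i ≤ g i) → prodFin f ≤ prodFin g
prodFin-mono-≤ {zero}  f≤g = ≤-refl
prodFin-mono-≤ {suc q} f≤g = *-mono-≤ (f≤g zero) (prodFin-mono-≤ (f≤g ∘ suc))

updateAt₂-pointwise : ∀ {a b r n} {A : Set a} {B : Set b} {R : Fin n → A → B → Set r}
                      {xs : Vector A n} {ys : Vector B n} j {f : A → A} {g : B → B} →
                      (∀ i → R i (xs i) (ys i)) → R j (f (xs j)) (g (ys j)) →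
                      ∀ i → R i (updateAt xs j f i) (updateAt ys j g i)
updateAt₂-pointwise zero    old new zero    = new
updateAt₂-pointwise zero    old new (suc i) = old (suc i)
updateAt₂-pointwise (suc j) old new zero    = old zero
updateAt₂-pointwise {R = R} (suc j) old new (suc i) =
  updateAt₂-pointwise {R = R ∘ suc} j (old ∘ suc) new i

module Sumsets {c ℓ} (G : AbelianGroup c ℓ) where
  open AbelianGroup G renaming (refl to ≈-refl)
  open import Algebra.Definitions.RawMonoid rawMonoid using () renaming (_×_ to _·_)
  open import Algebra.Properties.Monoid.Mult monoid using (×-homo-+)
  open import Algebra.Properties.CommutativeMonoid.Sum commutativeMonoid using ()
    renaming (sum to ∑; sum-cong-≋ to ∑-cong; ∑-distrib-+ to ∑-distrib-∙; sum-replicate-zero to ∑-ε)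
  open import Algebra.Properties.CommutativeSemigroup commutativeSemigroup
    using (interchange; x∙yz≈y∙xz)
  open import Relation.Binary.Reasoning.Setoid setoid

  _⊗_ : ∀ {a} → ℕ → Subset G a → Subset G (c ⊔ ℓ ⊔ a)
  _⊗_ = Defs._⊗_ G

  _⊕L_ : ∀ {b} → List Carrier → Subset G b → Subset G (c ⊔ ℓ ⊔ b)
  _⊕L_ = Defs._⊕L_ G

  ⊗-resp-≈ : ∀ {a} {A : Subset G a} h {x y} → x ≈ y → (h ⊗ A) x → (h ⊗ A) y
  ⊗-resp-≈ zero    x≈y (lift x≈ε)              = lift (trans (sym x≈y) x≈ε)
  ⊗-resp-≈ (suc h) x≈y (u , v , Au , hv , x≈uv) = u , v , Au , hv , trans (sym x≈y) x≈uv

  ⊗-mono : ∀ {a b} {A : Subset G a} {B : Subset G b} h → A ⊆ B → (h ⊗ A) ⊆ (h ⊗ B)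
  ⊗-mono zero    A⊆B (lift z≈ε)              = lift z≈ε
  ⊗-mono (suc h) A⊆B (u , v , Au , hv , z≈uv) = u , v , A⊆B Au , ⊗-mono h A⊆B hv , z≈uv

  ⊗-+ : ∀ {a} {A : Subset G a} p q {x y} → (p ⊗ A) x → (q ⊗ A) y → ((p + q) ⊗ A) (x ∙ y)
  ⊗-+ zero    q (lift x≈ε) qy = ⊗-resp-≈ q (sym (trans (∙-congʳ x≈ε) (identityˡ _))) qy
  ⊗-+ (suc p) q {y = y} (u , v , Au , pv , x≈uv) qy =
    u , v ∙ y , Au , ⊗-+ p q pv qy , trans (∙-congʳ x≈uv) (assoc u v y)

  record SumsetSplit {p k} (P : Fin k → Subset G p) (h : ℕ) (z : Carrier) : Set (c ⊔ ℓ ⊔ p) where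
    field
      mult     : Vector ℕ k
      part     : Vector Carrier k
      sum-mult : sum mult ≡ h
      part∈    : ∀ j → (mult j ⊗ P j) (part j)
      z≈∑part  : z ≈ ∑ part

  ⊗-split : ∀ {a p k} {A : Subset G a} {P : Fin k → Subset G p} → A ⊆ ⋃ (Fin k) P →
            ∀ h {z} → (h ⊗ A) z → SumsetSplit P h z
  ⊗-split {k = k} A⊆⋃P zero (lift z≈ε) = record
    { mult     = λ _ → 0
    ; part     = λ _ → ε
    ; sum-mult = sum-replicate-zero k
    ; part∈    = λ _ → lift ≈-refl
    ; z≈∑part  = trans z≈ε (sym (∑-ε k))
    }
  ⊗-split {P = P} A⊆⋃P (suc h) (x , y , Ax , hy , z≈xy) with A⊆⋃P Ax | ⊗-split A⊆⋃P h hy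
  ... | j , Pjx | split = record
    { mult     = updateAt mult j suc
    ; part     = updateAt part j (x ∙_)
    ; sum-mult = ≡.trans (∑-updateAt +-0-commutativeMonoid mult j 1) (cong suc sum-mult)
    ; part∈    = updateAt₂-pointwise {R = λ i m w → (m ⊗ P i) w} j part∈
                                     (x , part j , Pjx , part∈ j , ≈-refl)
    ; z≈∑part  = trans z≈xy (trans (∙-congˡ z≈∑part) (sym (∑-updateAt commutativeMonoid part j x)))
    }
    where open SumsetSplit split

  ⊗-∑ : ∀ {a p k} {A : Subset G a} {P : Fin k → Subset G p} → (∀ {j} → P j ⊆ A) →
        (m : Vector ℕ k) (w : Vector Carrier k) → (∀ j → (m j ⊗ P j) (w j)) → (sum m ⊗ A) (∑ w)
  ⊗-∑ {k = zero}  P⊆A m w w∈ = lift ≈-refl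
  ⊗-∑ {k = suc k} P⊆A m w w∈ =
    ⊗-+ (head m) (sum (tail m)) (⊗-mono (head m) P⊆A (w∈ zero))
        (⊗-∑ P⊆A (tail m) (tail w) (w∈ ∘ suc))

  module _ (L : LinData G) where
    open LinData L

    combination : Vector ℕ dim → Carrier
    combination n = ∑ (λ j → n j · gens j)

    combination-+ : ∀ n n′ → combination (λ j → n j + n′ j) ≈ combination n ∙ combination n′
    combination-+ n n′ = trans (∑-cong (λ j → ×-homo-+ (gens j) (n j) (n′ j)))
                               (∑-distrib-∙ (λ j → n j · gens j) (λ j → n′ j · gens j))

    LinSet-shift : ∀ n {x} → LinSet G L x → LinSet G L (combination n ∙ x)
    LinSet-shift n {x} (n′ , x≈) = (λ j → n j + n′ j) , (begin
      combination n ∙ x                        ≈⟨ ∙-congˡ x≈ ⟩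
      combination n ∙ (base ∙ combination n′)  ≈⟨ x∙yz≈y∙xz _ base _ ⟩
      base ∙ (combination n ∙ combination n′)  ≈⟨ ∙-congˡ (combination-+ n n′) ⟨
      base ∙ combination (λ j → n j + n′ j)    ∎)

    ⊗-LinSet-shift : ∀ h n {x} → (suc h ⊗ LinSet G L) x → (suc h ⊗ LinSet G L) (combination n ∙ x)
    ⊗-LinSet-shift h n (u , v , Lu , hv , x≈uv) =
      combination n ∙ u , v , LinSet-shift n Lu , hv , trans (∙-congˡ x≈uv) (sym (assoc _ u v))

    ⊗-LinSet-peel : ∀ d h {z} → ((d + suc h) ⊗ LinSet G L) z →
                    Σ Carrier λ w → (suc h ⊗ LinSet G L) w × z ≈ d · base ∙ w
    ⊗-LinSet-peel zero    h {z} hz = z , hz , sym (identityˡ z)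
    ⊗-LinSet-peel (suc d) h {z} (x , y , (n , x≈) , hy , z≈xy) with ⊗-LinSet-peel d h hy
    ... | w , hw , y≈ = combination n ∙ w , ⊗-LinSet-shift h n hw , (begin
      z                                        ≈⟨ z≈xy ⟩
      x ∙ y                                    ≈⟨ ∙-cong x≈ y≈ ⟩
      (base ∙ combination n) ∙ (d · base ∙ w)  ≈⟨ interchange base _ _ w ⟩
      (base ∙ d · base) ∙ (combination n ∙ w)  ∎)

    ⊗-LinSet-peel-pred : ∀ {d m z} → d ≤ pred m → (m ⊗ LinSet G L) z →
                         Σ Carrier λ w → ((m ∸ d) ⊗ LinSet G L) w × z ≈ d · base ∙ w
    ⊗-LinSet-peel-pred {m = zero}  {z} z≤n hz = z , hz , sym (identityˡ z)
    ⊗-LinSet-peel-pred {d} {suc m} {z} d≤m hz =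
      let w , hw , z≈ = ⊗-LinSet-peel d (m ∸ d) (subst (λ n → (n ⊗ LinSet G L) z) 1+m≡d+[1+m∸d] hz)
      in  w , subst (λ n → (n ⊗ LinSet G L) w) (≡.sym (+-∸-assoc 1 d≤m)) hw , z≈
      where
        1+m≡d+[1+m∸d] : suc m ≡ d + suc (m ∸ d)
        1+m≡d+[1+m∸d] = ≡.sym (≡.trans (+-suc d (m ∸ d)) (cong suc (m+[n∸m]≡n d≤m)))

  ⊗-⋃LinSet-peel : ∀ {a k h R z} {A : Subset G a} (L : Fin k → LinData G) →
                   (∀ {j} → LinSet G (L j) ⊆ A) →
                   (split : SumsetSplit (LinSet G ∘ L) (h + R) z) →
                   (d : Vector ℕ k) → sum d ≡ R → (∀ j → d j ≤ pred (SumsetSplit.mult split j)) →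
                   Σ Carrier λ y → (h ⊗ A) y × z ≈ ∑ (λ j → d j · LinData.base (L j)) ∙ y
  ⊗-⋃LinSet-peel {h = h} {R} {z} {A} L L⊆A split d Σd≡R d≤m-1 =
    ∑ rest ,
    subst (λ n → (n ⊗ A) (∑ rest)) Σ[m∸d]≡h
          (⊗-∑ L⊆A (λ j → mult j ∸ d j) rest (proj₁ ∘ proj₂ ∘ peel)) ,
    (begin
      z                             ≈⟨ z≈∑part ⟩
      ∑ part                        ≈⟨ ∑-cong (proj₂ ∘ proj₂ ∘ peel) ⟩
      ∑ (λ j → d j · a j ∙ rest j)  ≈⟨ ∑-distrib-∙ (λ j → d j · a j) rest ⟩
      ∑ (λ j → d j · a j) ∙ ∑ rest  ∎)
    where
      open SumsetSplit split
      a : Vector Carrier _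
      a = LinData.base ∘ L
      peel : ∀ j → Σ Carrier λ w → ((mult j ∸ d j) ⊗ LinSet G (L j)) w × part j ≈ d j · a j ∙ w
      peel j = ⊗-LinSet-peel-pred (L j) (d≤m-1 j) (part∈ j)
      rest : Vector Carrier _
      rest = proj₁ ∘ peel
      Σ[m∸d]≡h : sum (λ j → mult j ∸ d j) ≡ h
      Σ[m∸d]≡h = ≡.trans (sum-∸ (λ j → ≤-trans (d≤m-1 j) pred[n]≤n))
                         (≡.trans (cong₂ _∸_ sum-mult Σd≡R) (m+n∸n≡m h R))

  AsymptoticApproxGroup : ∀ {a} → Subset G a → (r l : ℕ) → Set (c ⊔ ℓ ⊔ a)
  AsymptoticApproxGroup A r l = Σ ℕ λ h₀ → ∀ h → h₀ ≤ h →
    Σ (List Carrier) λ X → length X ≤ l × ((r * h) ⊗ A) ⊆ (X ⊕L (h ⊗ A))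

  unionOfLinSets⇒approx′ : ∀ {a k} {A : Subset G a} → UnionOfLinSets G A (suc k) →
                           ∀ r n .{{_ : NonZero n}} → suc r * k ≤ n →
                           AsymptoticApproxGroup A (suc r) ((n + k) C k)
  unionOfLinSets⇒approx′ {k = k} {A} (L , A⇔⋃L) r n rk≤n =
    suc r * (n + suc k) , λ h h₀≤h → X h , ≤-reflexive (length-X h) , covers h h₀≤h
    where
      a : Vector Carrier (suc k)
      a = LinData.base ∘ L
      X : ℕ → List Carrier
      X h = map (λ g → ∑ (λ j → spread n (r * h) g j · a j)) (compositions (suc k) n)
      length-X : ∀ h → length (X h) ≡ (n + k) C k
      length-X h = ≡.trans (length-map _ (compositions (suc k) n)) (length-compositions k n)
      covers : ∀ h → suc r * (n + suc k) ≤ h → ((suc r * h) ⊗ A) ⊆ (X h ⊕L (h ⊗ A))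
      covers h h₀≤h {z} hz = map⁺ (Any.map peel (spread-≤-pred n (r * h) mult bound))
        where
          split : SumsetSplit (LinSet G ∘ L) (suc r * h) z
          split = ⊗-split (proj₁ (A⇔⋃L _)) (suc r * h) hz
          open SumsetSplit split
          bound : (n + k) * suc (r * h / n) < sum mult
          bound = <-≤-trans (spread-threshold r k n h rk≤n h₀≤h) (≤-reflexive (≡.sym sum-mult))
          peel : ∀ {g} → sum (spread n (r * h) g) ≡ r * h ×
                         (∀ j → spread n (r * h) g j ≤ pred (mult j)) →
                 Σ Carrier λ y → (h ⊗ A) y × z ≈ ∑ (λ j → spread n (r * h) g j · a j) ∙ y
          peel {g} (Σd≡rh , d≤m-1) =
            ⊗-⋃LinSet-peel L (λ Lx → proj₂ (A⇔⋃L _) (_ , Lx)) split (spread n (r * h) g) Σd≡rh d≤m-1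

  -- n = r(k - 1) parts, except n = 1 when k = 1: n must be nonzero, and C(0, 0) = 1 either way.
  unionOfLinSets⇒approx : ∀ {a k} {A : Subset G a} → 1 ≤ k → UnionOfLinSets G A k →
                          ∀ r → AsymptoticApproxGroup A (suc r) ((suc (suc r) * (k ∸ 1)) C (k ∸ 1))
  unionOfLinSets⇒approx {k = 1} _ U r =
    unionOfLinSets⇒approx′ U r 1 (≤-trans (≤-reflexive (*-zeroʳ (suc r))) z≤n)
  unionOfLinSets⇒approx {k = suc (suc k)} {A} _ U r =
    subst (AsymptoticApproxGroup A (suc r)) (cong (_C suc k) (+-comm (suc r * suc k) (suc k)))
          (unionOfLinSets⇒approx′ U r (suc r * suc k) ≤-refl)

  sumsetList : ∀ {q} → (Fin q → List Carrier) → List Carrier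
  sumsetList {zero}  X = [ ε ]
  sumsetList {suc q} X = cartesianProductWith _∙_ (X zero) (sumsetList (X ∘ suc))

  length-sumsetList : ∀ {q} (X : Fin q → List Carrier) →
                      length (sumsetList X) ≡ prodFin (λ i → length (X i))
  length-sumsetList {zero}  X = refl
  length-sumsetList {suc q} X =
    ≡.trans (length-cartesianProductWith _∙_ (X zero) (sumsetList (X ∘ suc)))
            (cong (length (X zero) *_) (length-sumsetList (X ∘ suc)))

  ⊕L-dotSum : ∀ {a q} {A : Fin q → Subset G a} {h′ h : Vector ℕ q} {X : Fin q → List Carrier} →
              (∀ i → (h′ i ⊗ A i) ⊆ (X i ⊕L (h i ⊗ A i))) →
              dotSum G h′ A ⊆ (sumsetList X ⊕L dotSum G h A)
  ⊕L-dotSum {q = zero} covers (lift z≈ε) = here (ε , lift ≈-refl , trans z≈ε (sym (identityˡ ε)))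
  ⊕L-dotSum {q = suc q} {A} {h′} {h} covers {z} (x , y , hx , hy , z≈xy) =
    cartesianProductWith⁺ _∙_ combine (covers zero hx) (⊕L-dotSum (covers ∘ suc) hy)
    where
      combine : ∀ {x₀ y₀} → (Σ Carrier λ x′ → (h zero ⊗ A zero) x′ × x ≈ x₀ ∙ x′) →
                (Σ Carrier λ y′ → dotSum G (h ∘ suc) (A ∘ suc) y′ × y ≈ y₀ ∙ y′) →
                Σ Carrier λ w → dotSum G h A w × z ≈ (x₀ ∙ y₀) ∙ w
      combine {x₀} {y₀} (x′ , hx′ , x≈) (y′ , hy′ , y≈) =
        x′ ∙ y′ , (x′ , y′ , hx′ , hy′ , ≈-refl) ,
        trans z≈xy (trans (∙-cong x≈ y≈) (interchange x₀ x′ y₀ y′))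

  chromatic-of-components : ∀ {a q} {A : Fin q → Subset G a} {r} {l : Fin q → ℕ} →
                            (∀ i → AsymptoticApproxGroup (A i) r (l i)) →
                            ChromaticAsymptoticApproxGroup G A r (prodFin l)
  chromatic-of-components {A = A} {r} {l} approx = proj₁ ∘ approx , λ h h₀≤h →
    let covering : ∀ i → Σ (List Carrier) λ X →
                     length X ≤ l i × ((r * h i) ⊗ A i) ⊆ (X ⊕L (h i ⊗ A i))
        covering i = proj₂ (approx i) (h i) (h₀≤h i)
    in sumsetList (proj₁ ∘ covering) ,
       ≤-trans (≤-reflexive (length-sumsetList (proj₁ ∘ covering)))
               (prodFin-mono-≤ (proj₁ ∘ proj₂ ∘ covering)) ,
       λ _ → ⊕L-dotSum (proj₂ ∘ proj₂ ∘ covering)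

open Sumsets using (unionOfLinSets⇒approx; chromatic-of-components)

theorem1p15 : ∀ {c ℓ a : Level} (G : AbelianGroup c ℓ) (q : ℕ)
    (A : Fin q → Subset G a) (k : Fin q → ℕ) →
    (∀ i → 1 ≤ k i) → (∀ i → UnionOfLinSets G (A i) (k i)) →
    (r : ℕ) → 1 ≤ r →
    ChromaticAsymptoticApproxGroup G A r
      (prodFin (λ i → (suc r * (k i ∸ 1)) C (k i ∸ 1)))
theorem1p15 G q A k 1≤k U (suc r) _ =
  chromatic-of-components G {r = suc r} (λ i → unionOfLinSets⇒approx G (1≤k i) (U i) r)
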